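{- Let $f:\{0,1\}^n\to\{0,1\}^n$ be a Boolean network which is not the identity map. If $f$ has at least $2n$ fixed points, then $K_n\in\mathcal{G}(f)$.
   Context: A Boolean network with $n$ components is a map $f:\{0,1\}^n\to\{0,1\}^n$, $x\mapsto(f_1(x),\dots,f_n(x))$. A fixed point is $x$ with $f(x)=x$. For $i\in[n]=\{1,\dots,n\}$, $e_i$ denotes the configuration with a $1$ exactly in component $i$, and $x+y$ denotes componentwise addition modulo 2. The interaction graph $G(f)$ is the digraph with vertex set $[n]$ having an arc from $j$ to $i$ (loops allowed) if and only if there is $x$ with $f_i(x)\neq f_i(x+e_j)$. Networks $f,h$ are isomorphic if $h\circ\pi=\pi\circ f$ for some permutation $\pi$ of $\{0,1\}^n$; $\mathcal{G}(f)$ is the set of $G(h)$ for all $h$ isomorphic to $f$. $K_n$ is the complete digraph on $[n]$ with all $n^2$ arcs (including loops). -}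

module Defs where

open import Data.Bool using (Bool; not)
open import Data.Nat using (ℕ; _*_)
open import Data.Fin using (Fin)
open import Data.Vec using (Vec; lookup; updateAt)
open import Data.Product using (Σ; ∃; _×_)
open import Relation.Binary.PropositionalEquality using (_≡_; _≢_)
open import Function using (_∘_)
open import Function.Bundles using (_↔_; Inverse)
open import Function.Definitions using (Injective)

Config : ℕ → Set
Config n = Vec Bool n

BN : ℕ → Set
BN n = Config n → Config n

flipAt : ∀ {n} → Fin n → Config n → Config n
flipAt j x = updateAt x j not

-- arc j → i in the interaction graph G(f)
Arc : ∀ {n} → BN n → Fin n → Fin n → Set
Arc f j i = ∃ λ x → lookup (f x) i ≢ lookup (f (flipAt j x)) i

-- G(f) = K_n : every arc (including loops) is present
IsComplete : ∀ {n} → BN n → Set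
IsComplete {n} f = (j i : Fin n) → Arc f j i

IsFixed : ∀ {n} → BN n → Config n → Set
IsFixed f x = f x ≡ x

AtLeastFixed : ∀ {n} → ℕ → BN n → Set
AtLeastFixed {n} m f =
  Σ (Fin m → Config n) λ g → Injective _≡_ _≡_ g × (∀ k → IsFixed f (g k))

NotIdentity : ∀ {n} → BN n → Set
NotIdentity f = ∃ λ x → f x ≢ x

IsomorphicVia : ∀ {n} → (Config n ↔ Config n) → BN n → BN n → Set
IsomorphicVia π f h = ∀ x → h (Inverse.to π x) ≡ Inverse.to π (f x)

CompleteInOrbit : ∀ {n} → BN n → Set
CompleteInOrbit {n} f =
  Σ (Config n ↔ Config n) λ π → Σ (BN n) λ h → IsomorphicVia π f h × IsComplete h

-- Relabelling the configurations of f by a permutation π changes neither the number of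
-- fixed points nor the existence of a non-fixed point, but it lets us choose WHERE they
-- lie. For n ≥ 3 send a non-fixed point a to 0 and f a to 1 = (1,…,1), and send 2n − 1
-- fixed points other than f a to the n unit vectors eᵢ and the n − 1 vectors e₀ + eₖ.
-- In the relabelled network h, comparing h 0 = 1 with h eⱼ = eⱼ gives every arc j → i
-- with i ≠ j, and comparing h e₀ = e₀ with h (e₀ + eₖ) = e₀ + eₖ (or h e₁ with h (e₀ + e₁))
-- gives every loop. For n = 1, 2 there is no such f, since 2n + 1 > 2ⁿ, and for n = 0
-- every network is the identity.
module Submission where

open import Data.Bool using (Bool; true; false; not)
open import Data.Fin as Fin
  using (Fin; zero; suc; _↑ˡ_; _↑ʳ_; splitAt; join; punchIn; inject≤)
open import Data.Fin.Properties
  using ( 0≢1+n; suc-injective; ↑ˡ-injective; ↑ʳ-injective; splitAt-↑ˡ; splitAt-↑ʳ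
        ; join-splitAt; punchIn-injective; punchInᵢ≢i; inject≤-injective; any?
        ; injective⇒≤ )
open import Data.Nat using (ℕ; zero; suc; _+_; _*_; _^_; _≤_; _<_)
open import Data.Nat.Properties using (<-irrefl; ≤-reflexive; +-identityʳ)
open import Data.Product using (∃; _×_; _,_; proj₁; proj₂)
open import Data.Sum using (inj₁; inj₂; [_,_])
open import Data.Vec using ([]; lookup; replicate) renaming (_∷_ to _∷ᵥ_)
open import Data.Vec.Properties using (lookup∘updateAt; lookup∘updateAt′; lookup-replicate; ≡-dec)
open import Data.Vec.Functional using (Vector; _∷_; _++_)
open import Data.Vec.Functional.Properties using (lookup-++ˡ; lookup-++ʳ)
open import Data.Vec.Functional.Relation.Unary.All.Properties using (++⁺)
import Data.Bool.Properties as Bool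
open import Function using (_∘_)
open import Function.Bundles using (_↔_; Inverse; Injection; mk↔ₛ′)
open import Function.Properties.Inverse using (↔⇒↣)
open import Function.Construct.Composition using (_↔-∘_)
open import Function.Construct.Identity using (↔-id)
import Function.Construct.Composition as Comp
open import Function.Definitions using (Injective)
open import Relation.Binary.Definitions using (DecidableEquality)
open import Relation.Binary.PropositionalEquality
  using (_≡_; _≢_; refl; sym; trans; cong; subst; ≢-sym; module ≡-Reasoning)
open import Relation.Nullary using (yes; no; contradiction)

open import Defs

open Inverse using (to; from)

module _ {A : Set} where

  injective-∷ : ∀ {p} {x : A} {xs : Vector A p} →
                (∀ k → xs k ≢ x) → Injective _≡_ _≡_ xs → Injective _≡_ _≡_ (x ∷ xs)
  injective-∷ _     _      {zero}  {zero}  _  = refl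
  injective-∷ x∉xs  _      {zero}  {suc l} eq = contradiction (sym eq) (x∉xs l)
  injective-∷ x∉xs  _      {suc k} {zero}  eq = contradiction eq (x∉xs k)
  injective-∷ _     xs-inj {suc k} {suc l} eq = cong suc (xs-inj eq)

  injective-[,] : ∀ {p q} {xs : Vector A p} {ys : Vector A q} →
                  Injective _≡_ _≡_ xs → Injective _≡_ _≡_ ys → (∀ k l → xs k ≢ ys l) →
                  Injective _≡_ _≡_ [ xs , ys ]
  injective-[,] xs-inj _      _        {inj₁ k} {inj₁ l} eq = cong inj₁ (xs-inj eq)
  injective-[,] _      _      disjoint {inj₁ k} {inj₂ l} eq = contradiction eq (disjoint k l)
  injective-[,] _      _      disjoint {inj₂ k} {inj₁ l} eq = contradiction (sym eq) (disjoint l k)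
  injective-[,] _      ys-inj _        {inj₂ k} {inj₂ l} eq = cong inj₂ (ys-inj eq)

splitAt-injective : ∀ m {n} → Injective _≡_ _≡_ (splitAt m {n})
splitAt-injective m {n} {i} {j} eq = begin
  i                        ≡⟨ join-splitAt m n i ⟨
  join m n (splitAt m i)   ≡⟨ cong (join m n) eq ⟩
  join m n (splitAt m j)   ≡⟨ join-splitAt m n j ⟩
  j                        ∎
  where open ≡-Reasoning

injective-++ : ∀ {A : Set} {p q} {xs : Vector A p} {ys : Vector A q} →
               Injective _≡_ _≡_ xs → Injective _≡_ _≡_ ys → (∀ k l → xs k ≢ ys l) →
               Injective _≡_ _≡_ (xs ++ ys)
injective-++ {p = p} xs-inj ys-inj disjoint =
  Comp.injective _≡_ _≡_ _≡_ (splitAt-injective p) (injective-[,] xs-inj ys-inj disjoint)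

↑ˡ≢↑ʳ : ∀ {m n} (i : Fin m) (j : Fin n) → i ↑ˡ n ≢ m ↑ʳ j
↑ˡ≢↑ʳ {m} {n} i j eq
  with trans (sym (splitAt-↑ˡ m i n)) (trans (cong (splitAt m) eq) (splitAt-↑ʳ m n j))
... | ()

module _ {A : Set} (_≟_ : DecidableEquality A) where

  swap : A → A → A → A
  swap u v x with x ≟ u | x ≟ v
  ... | yes _ | _     = v
  ... | no _  | yes _ = u
  ... | no _  | no _  = x

  swap-left : ∀ u v → swap u v u ≡ v
  swap-left u v with u ≟ u
  ... | yes _   = refl
  ... | no u≢u  = contradiction refl u≢u

  swap-right : ∀ u v → swap u v v ≡ u
  swap-right u v with v ≟ u | v ≟ v
  ... | yes v≡u | _       = v≡u
  ... | no _    | yes _   = refl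
  ... | no _    | no v≢v  = contradiction refl v≢v

  swap-other : ∀ {u v x} → x ≢ u → x ≢ v → swap u v x ≡ x
  swap-other {u} {v} {x} x≢u x≢v with x ≟ u | x ≟ v
  ... | yes x≡u | _       = contradiction x≡u x≢u
  ... | no _    | yes x≡v = contradiction x≡v x≢v
  ... | no _    | no _    = refl

  swap-involutive : ∀ u v x → swap u v (swap u v x) ≡ x
  swap-involutive u v x with x ≟ u | x ≟ v
  ... | yes refl | _        = swap-right x v
  ... | no _     | yes refl = swap-left u x
  ... | no x≢u   | no x≢v   = swap-other x≢u x≢v

  transposition : A → A → A ↔ A
  transposition u v = mk↔ₛ′ (swap u v) (swap u v) (swap-involutive u v) (swap-involutive u v)

  opaque
    permutation-extending : ∀ p (s t : Fin p → A) → Injective _≡_ _≡_ s → Injective _≡_ _≡_ t →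
                            ∃ λ (π : A ↔ A) → ∀ k → to π (s k) ≡ t k
    permutation-extending zero s t _ _ = ↔-id A , λ ()
    permutation-extending (suc p) s t s-inj t-inj
      with permutation-extending p (s ∘ suc) (t ∘ suc) (suc-injective ∘ s-inj) (suc-injective ∘ t-inj)
    ... | π , π-extends = transposition (to π (s zero)) (t zero) ↔-∘ π , extends
      where
      extends : ∀ k → swap (to π (s zero)) (t zero) (to π (s k)) ≡ t k
      extends zero    = swap-left _ _
      extends (suc k) = trans (cong (swap _ _) (π-extends k)) (swap-other new≢old new≢t₀)
        where
        new≢old : t (suc k) ≢ to π (s zero)
        new≢old eq = 0≢1+n (sym (s-inj (Injection.injective (↔⇒↣ π) (trans (π-extends k) eq))))
        new≢t₀ : t (suc k) ≢ t zero
        new≢t₀ = 0≢1+n ∘ sym ∘ t-inj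

conjugate : ∀ {n} → Config n ↔ Config n → BN n → BN n
conjugate π f = to π ∘ f ∘ from π

conjugate-isomorphic : ∀ {n} (π : Config n ↔ Config n) (f : BN n) → IsomorphicVia π f (conjugate π f)
conjugate-isomorphic π f x = cong (to π ∘ f) (Inverse.strictlyInverseʳ π x)

conjugate-maps : ∀ {n} (π : Config n ↔ Config n) (f : BN n) {x y x′ y′} →
                 to π x ≡ x′ → to π y ≡ y′ → f x ≡ y → conjugate π f x′ ≡ y′
conjugate-maps π f {x} πx πy fx = begin
  conjugate π f _        ≡⟨ cong (conjugate π f) πx ⟨
  conjugate π f (to π x) ≡⟨ conjugate-isomorphic π f x ⟩
  to π (f x)             ≡⟨ cong (to π) fx ⟩
  to π _                 ≡⟨ πy ⟩
  _                      ∎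
  where open ≡-Reasoning

zeros : ∀ {n} → Config n
zeros = replicate _ false

ones : ∀ {n} → Config n
ones = replicate _ true

unit : ∀ {n} → Fin n → Config n
unit j = flipAt j zeros

-- pair k = e₀ + e₍ₖ₊₁₎
pair : ∀ {n} → Fin n → Config (suc n)
pair k = flipAt (suc k) (unit zero)

lookup-flipAt : ∀ {n} (j : Fin n) x → lookup (flipAt j x) j ≡ not (lookup x j)
lookup-flipAt j x = lookup∘updateAt j x

lookup-flipAt-other : ∀ {n} {i j : Fin n} x → i ≢ j → lookup (flipAt j x) i ≡ lookup x i
lookup-flipAt-other {i = i} {j} x i≢j = lookup∘updateAt′ i j i≢j x

lookup-unit : ∀ {n} (j : Fin n) → lookup (unit j) j ≡ true
lookup-unit j = trans (lookup-flipAt j zeros) (cong not (lookup-replicate j false))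

lookup-unit-other : ∀ {n} {i j : Fin n} → i ≢ j → lookup (unit j) i ≡ false
lookup-unit-other {i = i} i≢j = trans (lookup-flipAt-other zeros i≢j) (lookup-replicate i false)

lookup-unit₀-suc : ∀ {n} (k : Fin n) → lookup (unit zero) (suc k) ≡ false
lookup-unit₀-suc k = lookup-unit-other {i = suc k} {j = zero} λ ()

lookup-pair : ∀ {n} (k : Fin n) → lookup (pair k) (suc k) ≡ true
lookup-pair k = trans (lookup-flipAt (suc k) (unit zero)) (cong not (lookup-unit₀-suc k))

lookup-pair-other : ∀ {n} {k : Fin n} {i} → i ≢ zero → i ≢ suc k → lookup (pair k) i ≡ false
lookup-pair-other i≢0 i≢k = trans (lookup-flipAt-other (unit zero) i≢k) (lookup-unit-other i≢0)

true≢false : ∀ {b c : Bool} → b ≡ true → c ≡ false → b ≢ c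
true≢false refl refl ()

≢-at : ∀ {n} {x y : Config n} i → lookup x i ≡ true → lookup y i ≡ false → x ≢ y
≢-at i x[i] y[i] = true≢false x[i] y[i] ∘ cong (λ z → lookup z i)

lookup-≡ : ∀ {n} {x y : Config n} i {b} → x ≡ y → lookup y i ≡ b → lookup x i ≡ b
lookup-≡ i x≡y y[i] = trans (cong (λ z → lookup z i) x≡y) y[i]

fixesUnitsAndPairs⇒IsComplete : ∀ {m} (h : BN (suc (suc m))) → h zeros ≡ ones →
                                 (∀ j → IsFixed h (unit j)) → (∀ k → IsFixed h (pair k)) →
                                 IsComplete h
fixesUnitsAndPairs⇒IsComplete h h0 h-unit h-pair j i with i Fin.≟ j
... | no i≢j = zeros , true≢false (lookup-≡ i h0 (lookup-replicate i true))
                                  (lookup-≡ i (h-unit j) (lookup-unit-other i≢j))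
... | yes refl = loop i
  where
  loop : ∀ j → Arc h j j
  loop zero    = unit (suc zero) , λ eq →
    true≢false (lookup-≡ zero (h-pair zero) refl) (lookup-≡ zero (h-unit (suc zero)) refl) (sym eq)
  loop (suc k) = unit zero , λ eq →
    true≢false (lookup-≡ (suc k) (h-pair k) (lookup-pair k))
               (lookup-≡ (suc k) (h-unit zero) (lookup-unit₀-suc k)) (sym eq)

unit-injective : ∀ {n} → Injective _≡_ _≡_ (unit {n})
unit-injective {x = i} {j} eq with i Fin.≟ j
... | yes i≡j = i≡j
... | no i≢j  = contradiction eq (≢-at i (lookup-unit i) (lookup-unit-other i≢j))

pair-injective : ∀ {n} → Injective _≡_ _≡_ (pair {n})
pair-injective {x = k} {l} eq with k Fin.≟ l
... | yes k≡l = k≡l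
... | no k≢l  =
  contradiction eq (≢-at (suc k) (lookup-pair k) (lookup-pair-other (λ ()) (k≢l ∘ suc-injective)))

_≟ᶜ_ : ∀ {n} → DecidableEquality (Config n)
_≟ᶜ_ = ≡-dec Bool._≟_

fixed≢nonFixed : ∀ {n} {f : BN n} {x a} → IsFixed f x → f a ≢ a → x ≢ a
fixed≢nonFixed fx fa≢a refl = fa≢a fx

nonFixed∷fixed-injective : ∀ {n p} {f : BN n} {a} {xs : Vector (Config n) p} → f a ≢ a →
                           Injective _≡_ _≡_ xs → (∀ k → IsFixed f (xs k)) →
                           Injective _≡_ _≡_ (a ∷ xs)
nonFixed∷fixed-injective fa≢a xs-inj xs-fixed =
  injective-∷ (λ k → fixed≢nonFixed (xs-fixed k) fa≢a) xs-inj

AtLeastFixed-≤ : ∀ {n k m} {f : BN n} → k ≤ m → AtLeastFixed m f → AtLeastFixed k f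
AtLeastFixed-≤ k≤m (g , g-inj , g-fixed) =
  (λ i → g (inject≤ i k≤m)) , (λ eq → inject≤-injective k≤m k≤m _ _ (g-inj eq)) ,
  λ i → g-fixed (inject≤ i k≤m)

-- 2 ^ suc n unfolds to 2 ^ n + (2 ^ n + 0), whence the ↑ˡ 0.
encode : ∀ {n} → Config n → Fin (2 ^ n)
encode {zero}  []           = zero
encode {suc n} (false ∷ᵥ x) = encode x ↑ˡ (2 ^ n + 0)
encode {suc n} (true  ∷ᵥ x) = (2 ^ n) ↑ʳ (encode x ↑ˡ 0)

encode-injective : ∀ {n} → Injective _≡_ _≡_ (encode {n})
encode-injective {x = []}         {[]}         _  = refl
encode-injective {x = false ∷ᵥ x} {false ∷ᵥ y} eq =
  cong (false ∷ᵥ_) (encode-injective (↑ˡ-injective _ _ _ eq))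
encode-injective {x = false ∷ᵥ x} {true  ∷ᵥ y} eq = contradiction eq (↑ˡ≢↑ʳ (encode x) (encode y ↑ˡ 0))
encode-injective {x = true  ∷ᵥ x} {false ∷ᵥ y} eq = contradiction (sym eq) (↑ˡ≢↑ʳ (encode y) (encode x ↑ˡ 0))
encode-injective {x = true  ∷ᵥ x} {true  ∷ᵥ y} eq =
  cong (true ∷ᵥ_) (encode-injective (↑ˡ-injective 0 _ _ (↑ʳ-injective _ _ _ eq)))

fixedPoints<2^n : ∀ {n k} (f : BN n) → NotIdentity f → AtLeastFixed k f → k < 2 ^ n
fixedPoints<2^n f (a , fa≢a) (g , g-inj , g-fixed) =
  injective⇒≤ (Comp.injective _≡_ _≡_ _≡_ (nonFixed∷fixed-injective fa≢a g-inj g-fixed) encode-injective)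

reindex-avoiding : ∀ {A : Set} → DecidableEquality A → ∀ {p} (xs : Vector A (suc p)) →
                   Injective _≡_ _≡_ xs → (b : A) →
                   ∃ λ (ι : Fin p → Fin (suc p)) → Injective _≡_ _≡_ ι × ∀ k → xs (ι k) ≢ b
reindex-avoiding _≟_ xs xs-inj b with any? (λ i → xs i ≟ b)
... | yes (i , xsᵢ≡b) = punchIn i , punchIn-injective i _ _ ,
                        λ k eq → punchInᵢ≢i i k (xs-inj (trans eq (sym xsᵢ≡b)))
... | no b∉xs        = suc , suc-injective , λ k eq → b∉xs (suc k , eq)

module _ {m : ℕ} where

  private
    N : ℕ
    N = suc (suc (suc m))

  targets : Vector (Config N) (suc (suc (suc (suc m) + N)))
  targets = zeros ∷ ones ∷ (pair ++ unit)

  targets-injective : Injective _≡_ _≡_ targets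
  targets-injective =
    injective-∷ zeros-fresh (injective-∷ ones-fresh (injective-++ pair-injective unit-injective pair≢unit))
    where
    zeros-fresh : ∀ k → (ones ∷ (pair ++ unit)) k ≢ zeros
    zeros-fresh zero    = ≢-at zero refl refl
    zeros-fresh (suc k) = ++⁺ (_≢ zeros) {xs = pair} {ys = unit} pair≢zeros unit≢zeros k
      where
      pair≢zeros : ∀ k → pair k ≢ zeros
      pair≢zeros k = ≢-at zero refl refl
      unit≢zeros : ∀ j → unit j ≢ zeros
      unit≢zeros j = ≢-at j (lookup-unit j) (lookup-replicate j false)

    ones-fresh : ∀ k → (pair ++ unit) k ≢ ones
    ones-fresh = ++⁺ (_≢ ones) {xs = pair} {ys = unit} pair≢ones unit≢ones
      where
      pair≢ones : ∀ k → pair k ≢ ones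
      pair≢ones zero    = ≢-sym (≢-at (suc (suc zero)) refl refl)
      pair≢ones (suc k) = ≢-sym (≢-at (suc zero) refl refl)
      unit≢ones : ∀ j → unit j ≢ ones
      unit≢ones zero    = ≢-sym (≢-at (suc zero) refl refl)
      unit≢ones (suc j) = ≢-sym (≢-at zero refl refl)

    pair≢unit : ∀ k j → pair k ≢ unit j
    pair≢unit k zero    = ≢-at (suc k) (lookup-pair k) (lookup-unit₀-suc k)
    pair≢unit k (suc j) = ≢-at zero refl refl

  relabelled-isComplete : (f : BN N) {a : Config N} {xs : Vector (Config N) (suc (suc m) + N)} →
                          (∀ k → IsFixed f (xs k)) → (π : Config N ↔ Config N) →
                          (∀ k → to π ((a ∷ f a ∷ xs) k) ≡ targets k) → IsComplete (conjugate π f)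
  relabelled-isComplete f xs-fixed π π-maps = fixesUnitsAndPairs⇒IsComplete h h-zeros h-unit h-pair
    where
    h : BN N
    h = conjugate π f
    h-targets : ∀ k → IsFixed h ((pair ++ unit) k)
    h-targets k = conjugate-maps π f (π-maps (suc (suc k))) (π-maps (suc (suc k))) (xs-fixed k)
    h-zeros : h zeros ≡ ones
    h-zeros = conjugate-maps π f (π-maps zero) (π-maps (suc zero)) refl
    h-unit : ∀ j → IsFixed h (unit j)
    h-unit j = subst (IsFixed h) (lookup-++ʳ pair unit j) (h-targets (suc (suc m) ↑ʳ j))
    h-pair : ∀ k → IsFixed h (pair k)
    h-pair k = subst (IsFixed h) (lookup-++ˡ pair unit k) (h-targets (k ↑ˡ N))

  completeInOrbit : (f : BN N) → NotIdentity f → AtLeastFixed (N + N) f → CompleteInOrbit f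
  completeInOrbit f (a , fa≢a) (g , g-inj , g-fixed) with reindex-avoiding _≟ᶜ_ g g-inj (f a)
  ... | ι , ι-inj , fa∉g∘ι =
    π , conjugate π f , conjugate-isomorphic π f , relabelled-isComplete f (g-fixed ∘ ι) π π-maps
    where
    sources-injective : Injective _≡_ _≡_ (a ∷ f a ∷ g ∘ ι)
    sources-injective =
      injective-∷ a-fresh (injective-∷ fa∉g∘ι (Comp.injective _≡_ _≡_ _≡_ ι-inj g-inj))
      where
      a-fresh : ∀ k → (f a ∷ g ∘ ι) k ≢ a
      a-fresh zero    = fa≢a
      a-fresh (suc k) = fixed≢nonFixed (g-fixed (ι k)) fa≢a
    relabelling : ∃ λ (π : Config N ↔ Config N) → ∀ k → to π ((a ∷ f a ∷ g ∘ ι) k) ≡ targets k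
    relabelling = permutation-extending _≟ᶜ_ _ _ targets sources-injective targets-injective
    π = proj₁ relabelling
    π-maps = proj₂ relabelling

lemma1 : (n : ℕ) (f : BN n) → NotIdentity f → AtLeastFixed (2 * n) f → CompleteInOrbit f
lemma1 zero f (a , fa≢a) _ = contradiction (empty-unique (f a) a) fa≢a
  where
  empty-unique : (x y : Config 0) → x ≡ y
  empty-unique [] [] = refl
lemma1 1 f nonId fixed = contradiction (fixedPoints<2^n f nonId fixed) (<-irrefl refl)
lemma1 2 f nonId fixed = contradiction (fixedPoints<2^n f nonId fixed) (<-irrefl refl)
lemma1 n@(suc (suc (suc m))) f nonId fixed =
  completeInOrbit f nonId (AtLeastFixed-≤ {f = f} n+n≤2*n fixed)
  where
  n+n≤2*n : n + n ≤ 2 * n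
  n+n≤2*n = ≤-reflexive (cong (n +_) (sym (+-identityʳ n)))
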